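{- Let $\alpha\ge 1$ and let $G$ be the directed graph and $\mathcal{P}$ the path family described in the context. Each path in $\mathcal{P}$ is the only $\alpha$-approximate shortest path between its endpoints in $G$.
   Context: Let $n$ be divisible by $3$ and $m=n/3$. The directed graph $G=(V,E,w)$ has vertices $v_i^1,v_i^2,v_i^3$ for $i=1,\dots,m$, forming cycles $C_i$. If $i$ is odd, $C_i$ consists of edges $(v_i^1,v_i^2),(v_i^2,v_i^3),(v_i^3,v_i^1)$; if $i$ is even, $C_i$ consists of edges $(v_i^1,v_i^3),(v_i^3,v_i^2),(v_i^2,v_i^1)$. For every $i<m$ and $k\in\{1,2,3\}$ there is a cross-cycle edge $(v_i^k,v_{i+1}^k)$. Every edge of $C_i$ has weight $1/(3\alpha)^i$; every cross-cycle edge has weight $0$. The family $\mathcal{P}$: for each $i<m$ and each edge $(v_i^k,v_i^{k'})$ of $C_i$, $\mathcal{P}$ contains the path from $v_i^k$ to $v_{i+1}^{k'}$ that takes the edge $(v_i^k,v_{i+1}^k)$ and then follows $C_{i+1}$ from $v_{i+1}^k$ to $v_{i+1}^{k'}$ (two edges of $C_{i+1}$). A path from $s$ to $t$ is an $\alpha$-approximate shortest path if its weight is at most $\alpha$ times the $s$-$t$ distance.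
   Formalization: The parameter α ranges over the rationals with α ≥ 1, so the edge weights of G are rational. -}

module Defs where

open import Data.Nat as ℕ using (ℕ; zero; suc)
open import Data.Fin using (Fin; toℕ) renaming (zero to f0; suc to fs)
open import Data.Product using (_×_; _,_)
open import Data.List using (List; []; _∷_)
open import Data.List.Relation.Unary.Unique.Propositional using (Unique)
open import Data.Rational using (ℚ; 0ℚ; 1ℚ; _+_; _*_; _≤_; _<_; 1/_; NonZero; Positive; positive; >-nonZero)
open import Data.Rational.Properties using (<-≤-trans; pos*pos⇒pos; positive⁻¹)
open import Relation.Binary.PropositionalEquality using (_≡_)

3ℚ : ℚ
3ℚ = 1ℚ + 1ℚ + 1ℚ

invPow : (x : ℚ) → .{{NonZero x}} → ℕ → ℚ
invPow x zero = 1ℚ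
invPow x (suc i) = (1/ x) * invPow x i

3α-nonZero : (α : ℚ) → 1ℚ ≤ α → NonZero (3ℚ * α)
3α-nonZero α 1≤α =
  >-nonZero (positive⁻¹ (3ℚ * α) {{pos*pos⇒pos 3ℚ α {{positive (<-≤-trans (positive⁻¹ 1ℚ) 1≤α)}}}})

-- The graph G (m = n/3 cycles).
-- Vertex v_i^k of the paper is (i' , k') with toℕ i' = i - 1 and toℕ k' = k - 1.
-- So the paper's "i odd" corresponds to toℕ i' even.

V : ℕ → Set
V m = Fin m × Fin 3

-- 1 → 2 → 3 → 1   (paper orientation for odd i)
cycSucc : Fin 3 → Fin 3
cycSucc f0 = fs f0
cycSucc (fs f0) = fs (fs f0)
cycSucc (fs (fs f0)) = f0

-- 1 → 3 → 2 → 1   (paper orientation for even i)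
cycPred : Fin 3 → Fin 3
cycPred f0 = fs (fs f0)
cycPred (fs (fs f0)) = fs f0
cycPred (fs f0) = f0

-- successor of a vertex index on the cycle with 0-based index p
-- (p even  ↔  paper index p+1 odd)
cycNext : ℕ → Fin 3 → Fin 3
cycNext zero k = cycSucc k
cycNext (suc zero) k = cycPred k
cycNext (suc (suc p)) k = cycNext p k

data Edge {m : ℕ} : V m → V m → Set where
  cyc   : (i : Fin m) (k : Fin 3) → Edge (i , k) (i , cycNext (toℕ i) k)
  cross : (i j : Fin m) (k : Fin 3) → toℕ j ≡ suc (toℕ i) → Edge (i , k) (j , k)

-- Edge weights: edges of C_i weigh 1/(3α)^i (paper index i = toℕ i' + 1),
-- cross-cycle edges weigh 0.
weight : {m : ℕ} (α : ℚ) → 1ℚ ≤ α → {u v : V m} → Edge u v → ℚ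
weight α 1≤α (cyc i k) = invPow (3ℚ * α) {{3α-nonZero α 1≤α}} (suc (toℕ i))
weight α 1≤α (cross i j k _) = 0ℚ

data Walk {m : ℕ} : V m → V m → Set where
  []  : {v : V m} → Walk v v
  _∷_ : {u v w : V m} → Edge u v → Walk v w → Walk u w

infixr 5 _∷_

vertices : {m : ℕ} {s t : V m} → Walk s t → List (V m)
vertices {s = s} [] = s ∷ []
vertices {s = s} (e ∷ p) = s ∷ vertices p

IsPath : {m : ℕ} {s t : V m} → Walk s t → Set
IsPath p = Unique (vertices p)

pathWeight : {m : ℕ} (α : ℚ) → 1ℚ ≤ α → {s t : V m} → Walk s t → ℚ
pathWeight α h [] = 0ℚ
pathWeight α h (e ∷ p) = weight α h e + pathWeight α h p

-- p is an α-approximate shortest s-t path: it is a path and its weight is at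
-- most α times the s-t distance, i.e. at most α times the weight of every
-- s-t path (the distance is the minimum over the finitely many s-t paths).
IsApproxSP : {m : ℕ} (α : ℚ) → 1ℚ ≤ α → {s t : V m} → Walk s t → Set
IsApproxSP {m} α h {s} {t} p =
  IsPath p × ((q : Walk {m} s t) → IsPath q → pathWeight α h p ≤ α * pathWeight α h q)

-- The family 𝒫: for a cycle edge (v_i^k , v_i^{k'}) of C_i with i < m
-- (here i' , j with toℕ j = toℕ i' + 1), the path
--   v_i^k → v_{i+1}^k → (two edges of C_{i+1}) → v_{i+1}^{k'}.

pathP : {m : ℕ} (i j : Fin m) (k : Fin 3) (eq : toℕ j ≡ suc (toℕ i)) →
        Walk (i , k) (j , cycNext (toℕ j) (cycNext (toℕ j) k))
pathP i j k eq = cross i j k eq ∷ cyc j k ∷ cyc j (cycNext (toℕ j) k) ∷ []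

-- A path leaving v_i^k along C_i already weighs 1/(3α)^i = (3α/2)·w(P), where w(P) = 2/(3α)^{i+1},
-- and (3α/2)·w(P) exceeds α·w(P); so P is α-approximate and no such path is. Walks never decrease
-- the cycle index, so a path that instead starts with the cross edge stays in C_{i+1}, where the
-- only simple path from v_{i+1}^k to v_{i+1}^{k'} is the two-edge one.
module Submission where

open import Defs
open import Data.Nat using (ℕ; suc)
open import Data.Fin using (Fin; toℕ)
open import Data.Product using (_×_; _,_)
open import Data.Rational using (ℚ; 1ℚ; _≤_)
open import Relation.Binary.PropositionalEquality using (_≡_)

open import Data.Nat using (zero)
import Data.Nat as ℕ
import Data.Nat.Properties as ℕ
open import Data.Fin using () renaming (zero to f0; suc to fs)
open import Data.Fin.Properties using (toℕ-injective)
open import Data.Product using (Σ; proj₂)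
open import Data.Sum using (_⊎_; inj₁; inj₂)
open import Data.Empty using (⊥-elim)
open import Data.List using ([]; _∷_)
open import Data.List.Relation.Unary.All using ([]; _∷_)
open import Data.List.Relation.Unary.AllPairs using ([]; _∷_)
open import Data.Rational using (0ℚ; _+_; _*_; _<_; 1/_; NonZero; Positive; positive; nonNegative)
open import Data.Rational.Properties
  using (≤-refl; ≤-trans; ≤-reflexive; <-≤-trans; ≤-<-trans; <-irrefl; <⇒≤;
         *-assoc; *-identityˡ; *-inverseʳ; +-identityʳ; +-mono-≤; +-monoʳ-≤; +-monoʳ-<;
         *-monoʳ-≤-nonNeg; pos*pos⇒pos; positive⁻¹; 1/pos⇒pos; pos⇒nonZero; module ≤-Reasoning)
open import Data.Rational.Solver using (module +-*-Solver)
open import Relation.Binary.PropositionalEquality using (_≢_; ≢-sym; refl; sym; trans; cong; module ≡-Reasoning)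
open import Relation.Nullary using (¬_)
open import Function using (_∘′_)

cycNext-elim : (P : (Fin 3 → Fin 3) → Set) → P cycSucc → P cycPred → ∀ n → P (cycNext n)
cycNext-elim P succ pred zero = succ
cycNext-elim P succ pred (suc zero) = pred
cycNext-elim P succ pred (suc (suc n)) = cycNext-elim P succ pred n

cycNext-noFix : ∀ n k → cycNext n k ≢ k
cycNext-noFix = cycNext-elim (λ f → ∀ k → f k ≢ k)
  (λ { f0 () ; (fs f0) () ; (fs (fs f0)) () })
  (λ { f0 () ; (fs f0) () ; (fs (fs f0)) () })

cycNext³ : ∀ n k → cycNext n (cycNext n (cycNext n k)) ≡ k
cycNext³ = cycNext-elim (λ f → ∀ k → f (f (f k)) ≡ k)
  (λ { f0 → refl ; (fs f0) → refl ; (fs (fs f0)) → refl })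
  (λ { f0 → refl ; (fs f0) → refl ; (fs (fs f0)) → refl })

cycNext²-noFix : ∀ n k → cycNext n (cycNext n k) ≢ k
cycNext²-noFix n k c²k≡k = cycNext-noFix n k (trans (sym (cong (cycNext n) c²k≡k)) (cycNext³ n k))

-- Consecutive cycles are oriented oppositely, so two steps forward on C_{i+1} are one step on C_i.
cycNext-suc² : ∀ n k → cycNext (suc n) (cycNext (suc n) k) ≡ cycNext n k
cycNext-suc² zero f0 = refl
cycNext-suc² zero (fs f0) = refl
cycNext-suc² zero (fs (fs f0)) = refl
cycNext-suc² (suc zero) f0 = refl
cycNext-suc² (suc zero) (fs f0) = refl
cycNext-suc² (suc zero) (fs (fs f0)) = refl
cycNext-suc² (suc (suc n)) k = cycNext-suc² n k

index : {m : ℕ} → V m → ℕ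
index (i , _) = toℕ i

walk-index-mono : {m : ℕ} {u v : V m} → Walk u v → index u ℕ.≤ index v
walk-index-mono [] = ℕ.≤-refl
walk-index-mono (cyc i k ∷ w) = walk-index-mono w
walk-index-mono (cross i j k j≡1+i ∷ w) =
  ℕ.≤-trans (ℕ.≤-trans (ℕ.n≤1+n _) (ℕ.≤-reflexive (sym j≡1+i))) (walk-index-mono w)

no-backward-walk : {m : ℕ} {u v : V m} → index v ℕ.< index u → ¬ Walk u v
no-backward-walk v<u w = ℕ.<⇒≱ v<u (walk-index-mono w)

twoStep : {m : ℕ} (j : Fin m) (a : Fin 3) → Walk (j , a) (j , cycNext (toℕ j) (cycNext (toℕ j) a))
twoStep j a = cyc j a ∷ cyc j (cycNext (toℕ j) a) ∷ []

twoStep-isPath : {m : ℕ} (j : Fin m) (a : Fin 3) → IsPath (twoStep j a)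
twoStep-isPath j a =
    (differ (≢-sym (cycNext-noFix n a)) ∷ differ (≢-sym (cycNext²-noFix n a)) ∷ [])
  ∷ (differ (≢-sym (cycNext-noFix n (cycNext n a))) ∷ [])
  ∷ []
  ∷ []
  where
    n : ℕ
    n = toℕ j
    differ : {b c : Fin 3} → b ≢ c → (j , b) ≢ (j , c)
    differ b≢c = b≢c ∘′ cong proj₂

-- The endpoint is generalised so that the empty walk and the one-edge walk can be matched.
twoStep-unique : {m : ℕ} (j : Fin m) (a b : Fin 3) (w : Walk (j , a) (j , b)) →
  b ≡ cycNext (toℕ j) (cycNext (toℕ j) a) → IsPath w →
  _≡_ {A = Σ (Fin 3) λ b → Walk (j , a) (j , b)} (b , w) (_ , twoStep j a)
twoStep-unique j a b [] b≡c²a _ = ⊥-elim (cycNext²-noFix (toℕ j) a (sym b≡c²a))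
twoStep-unique j a b (cyc _ _ ∷ []) b≡c²a _ = ⊥-elim (cycNext-noFix (toℕ j) _ (sym b≡c²a))
twoStep-unique j a b (cyc _ _ ∷ cyc _ _ ∷ []) _ _ = refl
twoStep-unique j a b (cyc _ _ ∷ cyc _ _ ∷ cyc _ _ ∷ []) _ ((_ ∷ _ ∷ a≢c³a ∷ []) ∷ _) =
  ⊥-elim (a≢c³a (cong (j ,_) (sym (cycNext³ (toℕ j) a))))
twoStep-unique j a b (cyc _ _ ∷ cyc _ _ ∷ cyc _ _ ∷ _ ∷ _) _ ((_ ∷ _ ∷ a≢c³a ∷ _) ∷ _) =
  ⊥-elim (a≢c³a (cong (j ,_) (sym (cycNext³ (toℕ j) a))))
twoStep-unique j a b (cross _ _ _ e ∷ w) _ _ = ⊥-elim (no-backward-walk (ℕ.≤-reflexive (sym e)) w)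
twoStep-unique j a b (cyc _ _ ∷ cross _ _ _ e ∷ w) _ _ = ⊥-elim (no-backward-walk (ℕ.≤-reflexive (sym e)) w)
twoStep-unique j a b (cyc _ _ ∷ cyc _ _ ∷ cross _ _ _ e ∷ w) _ _ = ⊥-elim (no-backward-walk (ℕ.≤-reflexive (sym e)) w)

pathP-isPath : {m : ℕ} (i j : Fin m) (k : Fin 3) (eq : toℕ j ≡ suc (toℕ i)) → IsPath (pathP i j k eq)
pathP-isPath i j k eq = (i≢j ∷ i≢j ∷ i≢j ∷ []) ∷ twoStep-isPath j k
  where
    i≢j : {a b : Fin 3} → (i , a) ≢ (j , b)
    i≢j i≡j = ℕ.1+n≢n (sym (trans (cong index i≡j) eq))

invPow-pos : (x : ℚ) .{{_ : Positive x}} → ∀ n → 0ℚ < invPow x {{pos⇒nonZero x}} n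
invPow-pos x zero = positive⁻¹ 1ℚ
invPow-pos x (suc n) = positive⁻¹ _
  {{pos*pos⇒pos (1/ x) {{1/pos⇒pos x}} (invPow x n) {{positive (invPow-pos x n)}}}}
  where instance _ = pos⇒nonZero x

*-invPow-suc : (x : ℚ) .{{_ : NonZero x}} → ∀ n → x * invPow x (suc n) ≡ invPow x n
*-invPow-suc x n = begin
  x * (1/ x * invPow x n)   ≡⟨ sym (*-assoc x (1/ x) (invPow x n)) ⟩
  x * 1/ x * invPow x n     ≡⟨ cong (_* invPow x n) (*-inverseʳ x) ⟩
  1ℚ * invPow x n           ≡⟨ *-identityˡ (invPow x n) ⟩
  invPow x n                ∎
  where open ≡-Reasoning

module _ (α : ℚ) (1≤α : 1ℚ ≤ α) where
  private instance
    3α-nonZero′ : NonZero (3ℚ * α)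
    3α-nonZero′ = 3α-nonZero α 1≤α

  0<α : 0ℚ < α
  0<α = <-≤-trans (positive⁻¹ 1ℚ) 1≤α

  cycleWeight : ℕ → ℚ
  cycleWeight n = invPow (3ℚ * α) (suc n)

  cycleWeight-pos : ∀ n → 0ℚ < cycleWeight n
  cycleWeight-pos n = invPow-pos (3ℚ * α) {{pos*pos⇒pos 3ℚ α {{positive 0<α}}}} (suc n)

  pathWeight-nonNeg : {m : ℕ} {s t : V m} (w : Walk s t) → 0ℚ ≤ pathWeight α 1≤α w
  pathWeight-nonNeg [] = ≤-refl
  pathWeight-nonNeg (cyc i k ∷ w) =
    ≤-trans (≤-reflexive (sym (+-identityʳ 0ℚ))) (+-mono-≤ (<⇒≤ (cycleWeight-pos (toℕ i))) (pathWeight-nonNeg w))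
  pathWeight-nonNeg (cross i j k _ ∷ w) =
    ≤-trans (≤-reflexive (sym (+-identityʳ 0ℚ))) (+-mono-≤ ≤-refl (pathWeight-nonNeg w))

  x≤α*x : {x : ℚ} → 0ℚ ≤ x → x ≤ α * x
  x≤α*x {x} 0≤x = ≤-trans (≤-reflexive (sym (*-identityˡ x))) (*-monoʳ-≤-nonNeg x {{nonNegative 0≤x}} 1≤α)

  α*pathP-weight<cycleWeight : {m : ℕ} (i j : Fin m) (k : Fin 3) (eq : toℕ j ≡ suc (toℕ i)) →
    α * pathWeight α 1≤α (pathP i j k eq) < cycleWeight (toℕ i)
  α*pathP-weight<cycleWeight i j k eq = begin-strict
    α * (0ℚ + (b + (b + 0ℚ)))   ≡⟨ solve 2 (λ a b → a :* (con 0ℚ :+ (b :+ (b :+ con 0ℚ))) := (a :* b :+ a :* b) :+ con 0ℚ) refl α b ⟩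
    (c + c) + 0ℚ                <⟨ +-monoʳ-< (c + c) 0<c ⟩
    (c + c) + c                 ≡⟨ solve 2 (λ a b → (a :* b :+ a :* b) :+ a :* b := (con 1ℚ :+ con 1ℚ :+ con 1ℚ) :* a :* b) refl α b ⟩
    3ℚ * α * cycleWeight (toℕ j)           ≡⟨ cong (λ n → 3ℚ * α * cycleWeight n) eq ⟩
    3ℚ * α * cycleWeight (suc (toℕ i))     ≡⟨ *-invPow-suc (3ℚ * α) (suc (toℕ i)) ⟩
    cycleWeight (toℕ i)                    ∎
    where
      open ≤-Reasoning
      open +-*-Solver
      b c : ℚ
      b = cycleWeight (toℕ j)
      c = α * b
      0<c : 0ℚ < c
      0<c = positive⁻¹ c {{pos*pos⇒pos α {{positive 0<α}} b {{positive (cycleWeight-pos (toℕ j))}}}}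

  heavy-or-pathP : {m : ℕ} (i j : Fin m) (k t : Fin 3) (eq : toℕ j ≡ suc (toℕ i)) (q : Walk (i , k) (j , t)) →
    t ≡ cycNext (toℕ j) (cycNext (toℕ j) k) → IsPath q →
    cycleWeight (toℕ i) ≤ pathWeight α 1≤α q
      ⊎ _≡_ {A = Σ (Fin 3) λ t → Walk (i , k) (j , t)} (t , q) (_ , pathP i j k eq)
  heavy-or-pathP i .i k .k eq [] _ _ = ⊥-elim (ℕ.1+n≢n (sym eq))
  heavy-or-pathP i j k t eq (cyc _ _ ∷ r) _ _ =
    inj₁ (≤-trans (≤-reflexive (sym (+-identityʳ (cycleWeight (toℕ i)))))
                  (+-monoʳ-≤ (cycleWeight (toℕ i)) (pathWeight-nonNeg r)))
  heavy-or-pathP i j k t eq (cross _ j′ _ e ∷ r) t≡c²k (_ ∷ r-isPath) with toℕ-injective (trans e (sym eq))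
  ... | refl with ℕ.≡-irrelevant e eq | twoStep-unique j k t r t≡c²k r-isPath
  ... | refl | refl = inj₂ refl

lemma2p3 : (α : ℚ) → (h : 1ℚ ≤ α) → (m : ℕ) →
    (i j : Fin m) → (k : Fin 3) → (eq : toℕ j ≡ suc (toℕ i)) →
    cycNext (toℕ j) (cycNext (toℕ j) k) ≡ cycNext (toℕ i) k ×
    IsApproxSP α h (pathP i j k eq) ×
    ((q : Walk (i , k) (j , cycNext (toℕ j) (cycNext (toℕ j) k))) →
      IsApproxSP α h q → vertices q ≡ vertices (pathP i j k eq))
lemma2p3 α h m i j k eq = endpoint , (pathP-isPath i j k eq , shortest) , unique
  where
    P : Walk (i , k) (j , cycNext (toℕ j) (cycNext (toℕ j) k))
    P = pathP i j k eq

    α*wP<wᵢ : α * pathWeight α h P < cycleWeight α h (toℕ i)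
    α*wP<wᵢ = α*pathP-weight<cycleWeight α h i j k eq

    wP≤α*wP : pathWeight α h P ≤ α * pathWeight α h P
    wP≤α*wP = x≤α*x α h (pathWeight-nonNeg α h P)

    endpoint : cycNext (toℕ j) (cycNext (toℕ j) k) ≡ cycNext (toℕ i) k
    endpoint = trans (cong (λ n → cycNext n (cycNext n k)) eq) (cycNext-suc² (toℕ i) k)

    shortest : (q : Walk (i , k) (j , cycNext (toℕ j) (cycNext (toℕ j) k))) → IsPath q →
      pathWeight α h P ≤ α * pathWeight α h q
    shortest q q-isPath with heavy-or-pathP α h i j k _ eq q refl q-isPath
    ... | inj₁ heavy = ≤-trans (<⇒≤ (≤-<-trans wP≤α*wP α*wP<wᵢ))
                                 (≤-trans heavy (x≤α*x α h (pathWeight-nonNeg α h q)))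
    ... | inj₂ refl = wP≤α*wP

    unique : (q : Walk (i , k) (j , cycNext (toℕ j) (cycNext (toℕ j) k))) →
      IsApproxSP α h q → vertices q ≡ vertices P
    unique q (q-isPath , q-approx) with heavy-or-pathP α h i j k _ eq q refl q-isPath
    ... | inj₁ heavy = ⊥-elim (<-irrefl refl (≤-<-trans (≤-trans heavy (q-approx P (pathP-isPath i j k eq))) α*wP<wᵢ))
    ... | inj₂ refl = refl
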